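{- Let $B=5$, let $\tilde p\neq0$ be an integer and $\tilde q$ a positive integer with $\tilde q\geqslant 3600\sqrt[3]{|\tilde p|}$. Let $F_2=B^{2}\tilde q^{6}-2B\tilde q^{4}-2B\tilde p\tilde q^{3}-2\tilde q^{2}+2\tilde p\tilde q+\tilde p^{2}-\frac5B-\frac{20}{B^{2}\tilde q^{2}}$, and consider the set of real $t$ with $F_2<t<F_2-\frac{10\tilde p}{B^{2}\tilde q^{3}}$ if $\tilde p<0$, respectively $F_2-\frac{10\tilde p}{B^{2}\tilde q^{3}}<t<F_2$ if $\tilde p>0$. This set contains at most one integer; an integer can occur only when $\tilde p<0$, and then it is $t=25\tilde q^{6}-10\tilde q^{4}-10\tilde p\tilde q^{3}-2\tilde q^{2}+2\tilde p\tilde q+\tilde p^{2}-1$. -}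

module Defs where

open import Data.Nat as ℕ using (ℕ; NonZero)
open import Data.Nat.Properties using (m*n≢0; m^n≢0)
open import Data.Integer as ℤ using (ℤ; +_)
open import Data.Rational as ℚ using (ℚ)

B : ℕ
B = 5

polyPart : ℤ → ℕ → ℤ
polyPart p q =
  (+ (B ℕ.^ 2)) ℤ.* (+ q) ℤ.^ 6
  ℤ.- (+ 2) ℤ.* (+ B) ℤ.* (+ q) ℤ.^ 4
  ℤ.- (+ 2) ℤ.* (+ B) ℤ.* p ℤ.* (+ q) ℤ.^ 3
  ℤ.- (+ 2) ℤ.* (+ q) ℤ.^ 2
  ℤ.+ (+ 2) ℤ.* p ℤ.* (+ q)
  ℤ.+ p ℤ.^ 2

F₂ : ℤ → (q : ℕ) → .{{NonZero q}} → ℚ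
F₂ p q =
  (polyPart p q ℚ./ 1)
  ℚ.- ((+ 5) ℚ./ B)
  ℚ.- (ℚ._/_ (+ 20) (B ℕ.^ 2 ℕ.* q ℕ.^ 2)
           {{m*n≢0 (B ℕ.^ 2) (q ℕ.^ 2) {{m^n≢0 B 2}} {{m^n≢0 q 2}}}})

G₂ : ℤ → (q : ℕ) → .{{NonZero q}} → ℚ
G₂ p q =
  F₂ p q ℚ.- (ℚ._/_ ((+ 10) ℤ.* p) (B ℕ.^ 2 ℕ.* q ℕ.^ 3)
                   {{m*n≢0 (B ℕ.^ 2) (q ℕ.^ 3) {{m^n≢0 B 2}} {{m^n≢0 q 3}}}})

tStar : ℤ → ℕ → ℤ
tStar p q =
  (+ 25) ℤ.* (+ q) ℤ.^ 6
  ℤ.- (+ 10) ℤ.* (+ q) ℤ.^ 4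
  ℤ.- (+ 10) ℤ.* p ℤ.* (+ q) ℤ.^ 3
  ℤ.- (+ 2) ℤ.* (+ q) ℤ.^ 2
  ℤ.+ (+ 2) ℤ.* p ℤ.* (+ q)
  ℤ.+ p ℤ.^ 2
  ℤ.- (+ 1)

{-# OPTIONS --safe #-}
module Submission where

-- Write T = tStar p q. Then F₂ = T − 20/(B²q²) and G₂ = F₂ − 10p/(B²q³), where
-- 0 ≤ 20/(B²q²) ≤ 4/5 and |10p/(B²q³)| ≤ 1/5. For p < 0 the interval (F₂, G₂)
-- therefore lies in (T − 1, T + 1), whose only integer is T; for p > 0 the
-- interval (G₂, F₂) lies in (T − 1, T), which contains no integer.

open import Defs
open import Data.Nat as ℕ using (ℕ; NonZero; suc)
import Data.Nat.Properties as ℕP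
import Data.Nat.Tactic.RingSolver as ℕSolver
open import Data.Integer as ℤ using (ℤ; +_; -[1+_]; +[1+_]; ∣_∣)
import Data.Integer.Properties as ℤP
open import Data.Integer.Tactic.RingSolver using (solve-∀)
open import Data.Rational as ℚ using (ℚ; toℚᵘ)
import Data.Rational.Properties as ℚP
import Data.Rational.Unnormalised as ℚᵘ
import Data.Rational.Unnormalised.Properties as ℚᵘP
open import Data.Product using (_×_; _,_)
open import Data.Sum using (_⊎_; inj₁; inj₂)
open import Data.Empty using (⊥; ⊥-elim)
open import Relation.Binary.PropositionalEquality

fromℤ : ℤ → ℚ
fromℤ i = i ℚ./ 1

toℚᵘ-/ : ∀ i n .{{_ : NonZero n}} → toℚᵘ (i ℚ./ n) ℚᵘ.≃ (i ℚᵘ./ n)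
toℚᵘ-/ i (suc n) = ℚP.toℚᵘ-fromℚᵘ (ℚᵘ.mkℚᵘ i n)

cross-≤⇒/≤/ : ∀ i n j m .{{_ : NonZero n}} .{{_ : NonZero m}} →
                 i ℤ.* + m ℤ.≤ j ℤ.* + n → i ℚ./ n ℚ.≤ j ℚ./ m
cross-≤⇒/≤/ i n@(suc _) j m@(suc _) im≤jn = ℚP.toℚᵘ-cancel-≤
  (ℚᵘP.≤-respˡ-≃ (ℚᵘP.≃-sym (toℚᵘ-/ i n))
    (ℚᵘP.≤-respʳ-≃ (ℚᵘP.≃-sym (toℚᵘ-/ j m)) (ℚᵘ.*≤* im≤jn)))

cross-≤ℕ⇒/≤/ : ∀ i n j m .{{_ : NonZero n}} .{{_ : NonZero m}} →
                  i ℕ.* m ℕ.≤ j ℕ.* n → + i ℚ./ n ℚ.≤ + j ℚ./ m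
cross-≤ℕ⇒/≤/ i n j m im≤jn = cross-≤⇒/≤/ (+ i) n (+ j) m
  (subst₂ ℤ._≤_ (ℤP.pos-* i m) (ℤP.pos-* j n) (ℤ.+≤+ im≤jn))

fromℤ-cancel-< : ∀ {i j} → fromℤ i ℚ.< fromℤ j → i ℤ.< j
fromℤ-cancel-< {i} {j} i<j
  with ℚᵘP.<-respˡ-≃ (toℚᵘ-/ i 1) (ℚᵘP.<-respʳ-≃ (toℚᵘ-/ j 1) (ℚP.toℚᵘ-mono-< i<j))
... | ℚᵘ.*<* i*1<j*1 = subst₂ ℤ._<_ (ℤP.*-identityʳ i) (ℤP.*-identityʳ j) i*1<j*1

fromℤ-homo-+ : ∀ i j → fromℤ (i ℤ.+ j) ≡ fromℤ i ℚ.+ fromℤ j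
fromℤ-homo-+ i j = ℚP.toℚᵘ-injective (begin
  toℚᵘ (fromℤ (i ℤ.+ j))                  ≈⟨ toℚᵘ-/ (i ℤ.+ j) 1 ⟩
  (i ℤ.+ j) ℚᵘ./ 1                        ≈⟨ ℚᵘ.*≡* (cross i j) ⟩
  (i ℚᵘ./ 1) ℚᵘ.+ (j ℚᵘ./ 1)              ≈⟨ ℚᵘP.+-cong (ℚᵘP.≃-sym (toℚᵘ-/ i 1)) (ℚᵘP.≃-sym (toℚᵘ-/ j 1)) ⟩
  toℚᵘ (fromℤ i) ℚᵘ.+ toℚᵘ (fromℤ j)      ≈⟨ ℚᵘP.≃-sym (ℚP.toℚᵘ-homo-+ (fromℤ i) (fromℤ j)) ⟩
  toℚᵘ (fromℤ i ℚ.+ fromℤ j)              ∎)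
  where
  open ℚᵘP.≃-Reasoning
  cross : ∀ i j → (i ℤ.+ j) ℤ.* (+ 1 ℤ.* + 1) ≡ (i ℤ.* + 1 ℤ.+ j ℤ.* + 1) ℤ.* + 1
  cross = solve-∀

i-1<j⇒i≤j : ∀ {i j} → i ℤ.- + 1 ℤ.< j → i ℤ.≤ j
i-1<j⇒i≤j {i} {j} i-1<j = subst (ℤ._≤ j) (suc[i-1]≡i i) (ℤP.i<j⇒suc[i]≤j i-1<j)
  where
  suc[i-1]≡i : ∀ i → + 1 ℤ.+ (i ℤ.- + 1) ≡ i
  suc[i-1]≡i = solve-∀

i<j+1⇒i≤j : ∀ {i j} → i ℤ.< j ℤ.+ + 1 → i ℤ.≤ j
i<j+1⇒i≤j {i} {j} i<j+1 = subst (i ℤ.≤_) (pred[j+1]≡j j) (ℤP.i<j⇒i≤pred[j] i<j+1)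
  where
  pred[j+1]≡j : ∀ j → ℤ.-1ℤ ℤ.+ (j ℤ.+ + 1) ≡ j
  pred[j+1]≡j = solve-∀

fromℤ-between : ∀ {i t j L U} → fromℤ i ℚ.≤ L → L ℚ.< fromℤ t → fromℤ t ℚ.< U → U ℚ.≤ fromℤ j →
                i ℤ.< t × t ℤ.< j
fromℤ-between i≤L L<t t<U U≤j =
  fromℤ-cancel-< (ℚP.≤-<-trans i≤L L<t) , fromℤ-cancel-< (ℚP.<-≤-trans t<U U≤j)

between-k±1⇒≡k : ∀ {k t L U} → fromℤ k ℚ.- ℚ.1ℚ ℚ.≤ L → L ℚ.< fromℤ t → fromℤ t ℚ.< U →
                 U ℚ.≤ fromℤ k ℚ.+ ℚ.1ℚ → t ≡ k
between-k±1⇒≡k {k} {t} k-1≤L L<t t<U U≤k+1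
  with fromℤ-between {k ℤ.- + 1} {t} {k ℤ.+ + 1} (subst (ℚ._≤ _) (sym (fromℤ-homo-+ k ℤ.-1ℤ)) k-1≤L)
                     L<t t<U (subst (_ ℚ.≤_) (sym (fromℤ-homo-+ k (+ 1))) U≤k+1)
... | k-1<t , t<k+1 = ℤP.≤-antisym (i<j+1⇒i≤j t<k+1) (i-1<j⇒i≤j k-1<t)

between-k-1-k⇒⊥ : ∀ {k t L U} → fromℤ k ℚ.- ℚ.1ℚ ℚ.≤ L → L ℚ.< fromℤ t → fromℤ t ℚ.< U →
                  U ℚ.≤ fromℤ k → ⊥
between-k-1-k⇒⊥ {k} {t} k-1≤L L<t t<U U≤k
  with fromℤ-between {k ℤ.- + 1} {t} {k} (subst (ℚ._≤ _) (sym (fromℤ-homo-+ k ℤ.-1ℤ)) k-1≤L)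
                     L<t t<U U≤k
... | k-1<t , t<k = ℤP.<-irrefl refl (ℤP.≤-<-trans (i-1<j⇒i≤j k-1<t) t<k)

p-q≤p : ∀ p {q} → ℚ.0ℚ ℚ.≤ q → p ℚ.- q ℚ.≤ p
p-q≤p p 0≤q = subst (p ℚ.- _ ℚ.≤_) (ℚP.+-identityʳ p) (ℚP.+-monoʳ-≤ p (ℚP.neg-antimono-≤ 0≤q))

p-1≤p-q : ∀ p {q} → q ℚ.≤ ℚ.1ℚ → p ℚ.- ℚ.1ℚ ℚ.≤ p ℚ.- q
p-1≤p-q p q≤1 = ℚP.+-monoʳ-≤ p (ℚP.neg-antimono-≤ q≤1)

p-q-r≤p+1 : ∀ p {q r} → ℚ.0ℚ ℚ.≤ q → ℚ.- ℚ.1ℚ ℚ.≤ r → (p ℚ.- q) ℚ.- r ℚ.≤ p ℚ.+ ℚ.1ℚ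
p-q-r≤p+1 p 0≤q -1≤r = ℚP.+-mono-≤ (p-q≤p p 0≤q) (ℚP.neg-antimono-≤ -1≤r)

p-1≤p-q-r : ∀ p {q r} → q ℚ.+ r ℚ.≤ ℚ.1ℚ → p ℚ.- ℚ.1ℚ ℚ.≤ (p ℚ.- q) ℚ.- r
p-1≤p-q-r p {q} {r} q+r≤1 = subst (p ℚ.- ℚ.1ℚ ℚ.≤_) p-[q+r]≡p-q-r (p-1≤p-q p q+r≤1)
  where
  p-[q+r]≡p-q-r : p ℚ.- (q ℚ.+ r) ≡ (p ℚ.- q) ℚ.- r
  p-[q+r]≡p-q-r = trans (cong (p ℚ.+_) (ℚP.neg-distrib-+ q r)) (sym (ℚP.+-assoc p (ℚ.- q) (ℚ.- r)))

module _ (q : ℕ) .{{_ : NonZero q}} where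
  private instance
    B²q²≢0 : NonZero (B ℕ.^ 2 ℕ.* q ℕ.^ 2)
    B²q²≢0 = ℕP.m*n≢0 (B ℕ.^ 2) (q ℕ.^ 2) {{ℕP.m^n≢0 B 2}} {{ℕP.m^n≢0 q 2}}
    B²q³≢0 : NonZero (B ℕ.^ 2 ℕ.* q ℕ.^ 3)
    B²q³≢0 = ℕP.m*n≢0 (B ℕ.^ 2) (q ℕ.^ 3) {{ℕP.m^n≢0 B 2}} {{ℕP.m^n≢0 q 3}}

  F₂-tail : ℚ
  F₂-tail = + 20 ℚ./ (B ℕ.^ 2 ℕ.* q ℕ.^ 2)

  G₂-offset : ℤ → ℚ
  G₂-offset p = (+ 10 ℤ.* p) ℚ./ (B ℕ.^ 2 ℕ.* q ℕ.^ 3)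

  F₂≡tStar-tail : ∀ p → F₂ p q ≡ fromℤ (tStar p q) ℚ.- F₂-tail
  F₂≡tStar-tail p = cong (ℚ._- F₂-tail) (sym (fromℤ-homo-+ (polyPart p q) ℤ.-1ℤ))

  0≤F₂-tail : ℚ.0ℚ ℚ.≤ F₂-tail
  0≤F₂-tail = cross-≤ℕ⇒/≤/ 0 1 20 (B ℕ.^ 2 ℕ.* q ℕ.^ 2) ℕ.z≤n

  F₂-tail≤4/5 : F₂-tail ℚ.≤ + 4 ℚ./ 5
  F₂-tail≤4/5 = cross-≤ℕ⇒/≤/ 20 (B ℕ.^ 2 ℕ.* q ℕ.^ 2) 4 5
    (subst (100 ℕ.≤_) (ℕP.*-assoc 4 25 (q ℕ.^ 2)) (ℕP.m≤m*n 100 (q ℕ.^ 2) {{ℕP.m^n≢0 q 2}}))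

  10m/B²q³≤1/5 : ∀ m → 3600 ℕ.^ 3 ℕ.* m ℕ.≤ q ℕ.^ 3 → + (10 ℕ.* m) ℚ./ (B ℕ.^ 2 ℕ.* q ℕ.^ 3) ℚ.≤ + 1 ℚ./ 5
  10m/B²q³≤1/5 m hyp = cross-≤ℕ⇒/≤/ (10 ℕ.* m) (B ℕ.^ 2 ℕ.* q ℕ.^ 3) 1 5 (begin
    10 ℕ.* m ℕ.* 5      ≡⟨ 10m5≡25[2m] m ⟩
    25 ℕ.* (2 ℕ.* m)    ≤⟨ ℕP.*-monoʳ-≤ 25 (ℕP.≤-trans (ℕP.*-monoˡ-≤ m 2≤3600³) hyp) ⟩
    25 ℕ.* q ℕ.^ 3      ≡⟨ ℕP.*-identityˡ (25 ℕ.* q ℕ.^ 3) ⟨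
    1 ℕ.* (25 ℕ.* q ℕ.^ 3) ∎)
    where
    open ℕP.≤-Reasoning
    10m5≡25[2m] : ∀ m → 10 ℕ.* m ℕ.* 5 ≡ 25 ℕ.* (2 ℕ.* m)
    10m5≡25[2m] = ℕSolver.solve-∀
    -- only 2m ≤ q³ is needed; the paper's bound 3600³m ≤ q³ serves elsewhere
    2≤3600³ : 2 ℕ.≤ 3600 ℕ.^ 3
    2≤3600³ = ℕ.s≤s (ℕ.s≤s ℕ.z≤n)

  F₂-lower : ∀ p → fromℤ (tStar p q) ℚ.- ℚ.1ℚ ℚ.≤ F₂ p q
  F₂-lower p = ℚP.≤-trans (p-1≤p-q (fromℤ (tStar p q)) (ℚP.≤-trans F₂-tail≤4/5 4/5≤1))
                          (ℚP.≤-reflexive (sym (F₂≡tStar-tail p)))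
    where
    4/5≤1 : + 4 ℚ./ 5 ℚ.≤ ℚ.1ℚ
    4/5≤1 = cross-≤ℕ⇒/≤/ 4 5 1 1 (ℕP.n≤1+n 4)

  F₂-upper : ∀ p → F₂ p q ℚ.≤ fromℤ (tStar p q)
  F₂-upper p = ℚP.≤-trans (ℚP.≤-reflexive (F₂≡tStar-tail p)) (p-q≤p (fromℤ (tStar p q)) 0≤F₂-tail)

  G₂≡tStar-tail-offset : ∀ p → G₂ p q ≡ (fromℤ (tStar p q) ℚ.- F₂-tail) ℚ.- G₂-offset p
  G₂≡tStar-tail-offset p = cong (ℚ._- G₂-offset p) (F₂≡tStar-tail p)

  G₂-upper-neg : ∀ n → 3600 ℕ.^ 3 ℕ.* suc n ℕ.≤ q ℕ.^ 3 →
                 G₂ -[1+ n ] q ℚ.≤ fromℤ (tStar -[1+ n ] q) ℚ.+ ℚ.1ℚ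
  G₂-upper-neg n hyp = ℚP.≤-trans (ℚP.≤-reflexive (G₂≡tStar-tail-offset -[1+ n ]))
    (p-q-r≤p+1 (fromℤ (tStar -[1+ n ] q)) 0≤F₂-tail -1≤offset)
    where
    1/5≤1 : + 1 ℚ./ 5 ℚ.≤ ℚ.1ℚ
    1/5≤1 = cross-≤ℕ⇒/≤/ 1 5 1 1 (ℕ.s≤s ℕ.z≤n)
    -1≤offset : ℚ.- ℚ.1ℚ ℚ.≤ G₂-offset -[1+ n ]
    -1≤offset = ℚP.neg-antimono-≤ (ℚP.≤-trans (10m/B²q³≤1/5 (suc n) hyp) 1/5≤1)

  G₂-lower-pos : ∀ n → 3600 ℕ.^ 3 ℕ.* suc n ℕ.≤ q ℕ.^ 3 →
                 fromℤ (tStar +[1+ n ] q) ℚ.- ℚ.1ℚ ℚ.≤ G₂ +[1+ n ] q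
  G₂-lower-pos n hyp = ℚP.≤-trans
    (p-1≤p-q-r (fromℤ (tStar +[1+ n ] q)) (ℚP.+-mono-≤ F₂-tail≤4/5 (10m/B²q³≤1/5 (suc n) hyp)))
    (ℚP.≤-reflexive (sym (G₂≡tStar-tail-offset +[1+ n ])))

theorem7p8 : (p : ℤ) (q : ℕ) .{{_ : NonZero q}} → p ≢ ℤ.0ℤ
    → 3600 ℕ.^ 3 ℕ.* ∣ p ∣ ℕ.≤ q ℕ.^ 3
    → (t : ℤ)
    → ((p ℤ.< ℤ.0ℤ × F₂ p q ℚ.< (t ℚ./ 1) × (t ℚ./ 1) ℚ.< G₂ p q)
       ⊎ (ℤ.0ℤ ℤ.< p × G₂ p q ℚ.< (t ℚ./ 1) × (t ℚ./ 1) ℚ.< F₂ p q))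
    → (p ℤ.< ℤ.0ℤ) × (t ≡ tStar p q)
theorem7p8 (+ 0) q p≢0 _ _ _ = ⊥-elim (p≢0 refl)
theorem7p8 +[1+ n ] q _ _ _ (inj₁ (ℤ.+<+ () , _))
theorem7p8 p@(+[1+ n ]) q _ hyp t (inj₂ (_ , G<t , t<F)) =
  ⊥-elim (between-k-1-k⇒⊥ {tStar p q} {t} (G₂-lower-pos q n hyp) G<t t<F (F₂-upper q +[1+ n ]))
theorem7p8 p@(-[1+ n ]) q _ hyp t (inj₁ (p<0 , F<t , t<G)) =
  p<0 , between-k±1⇒≡k {tStar p q} {t} (F₂-lower q -[1+ n ]) F<t t<G (G₂-upper-neg q n hyp)
theorem7p8 -[1+ n ] q _ _ _ (inj₂ (() , _))
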